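{- Let $H$ be a graph on $k \geq 2$ vertices and let $U \subseteq V(H)$. Let $c \geq 1$ be an integer and let $G$ be any $c$-closed graph on $n$ vertices. Then the number of sets $S \subseteq V(G)$ such that $G[S]$ is a maximal $U$-clique prescribed blow-up of $H$ in $G$ is at most \[ n^{\max(c-1,1)\,k} \cdot \min\left\{3^{(c-1)k/3}n^{2k},\ 4^{(c+4)(c-1)k/2}n^{(2-2^{1-c})k}\right\}. \]
   Context: All graphs are finite, simple and undirected. A graph $G$ is $c$-closed (for an integer $c\ge 1$) if any two distinct non-adjacent vertices of $G$ have fewer than $c$ common neighbours. For $S\subseteq V(G)$, $G[S]$ denotes the induced subgraph. Given a graph $H$ with $V(H)=\{1,\dots,k\}$ and $U\subseteq V(H)$, a $U$-clique prescribed blow-up of $H$ is a graph $H'$ whose vertex set is partitioned into nonempty sets $V_1\sqcup\dots\sqcup V_k$ such that whenever $ij\in E(H)$ every vertex of $V_i$ is adjacent to every vertex of $V_j$, and for each $i\in U$ the set $V_i$ is a clique (no other adjacency or non-adjacency is required). $G[S]$ is a maximal $U$-clique prescribed blow-up of $H$ in $G$ if $G[S]$ is such a blow-up (for some partition) and there is no $S'$ with $S\subsetneq S'\subseteq V(G)$ such that $G[S']$ is such a blow-up. -}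

module Defs where

open import Data.Nat using (ℕ; _<_)
open import Data.Bool using (Bool; true; false)
open import Data.Fin using (Fin)
open import Data.Fin.Subset using (Subset; _∈_; _⊂_; _∩_; ∣_∣)
open import Data.Vec using (tabulate)
open import Data.Product using (Σ; _×_; ∃)
open import Relation.Nullary using (¬_)
open import Relation.Binary.PropositionalEquality using (_≡_; _≢_)

record Graph (n : ℕ) : Set where
  field
    adj    : Fin n → Fin n → Bool
    sym    : ∀ u v → adj u v ≡ adj v u
    irrefl : ∀ u → adj u u ≡ false
open Graph public

nbhd : ∀ {n} → Graph n → Fin n → Subset n
nbhd G u = tabulate (adj G u)

CClosed : ∀ {n} → ℕ → Graph n → Set
CClosed c G = ∀ u v → u ≢ v → adj G u v ≡ false → ∣ nbhd G u ∩ nbhd G v ∣ < c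

-- G[S] is a U-clique prescribed blow-up of H: there is an assignment f of
-- the vertices of S to parts V_1..V_k (V_i = {v ∈ S | f v ≡ i}; values of f
-- outside S are irrelevant) with every part nonempty, complete joins along
-- edges of H, and V_i a clique for i ∈ U.
IsBlowup : ∀ {n k} → Graph n → Graph k → Subset k → Subset n → Set
IsBlowup {n} {k} G H U S =
  Σ (Fin n → Fin k) λ f →
    (∀ i → ∃ λ v → v ∈ S × f v ≡ i)
  × (∀ u v → u ∈ S → v ∈ S → adj H (f u) (f v) ≡ true → adj G u v ≡ true)
  × (∀ u v → u ∈ S → v ∈ S → u ≢ v → f u ≡ f v → f u ∈ U → adj G u v ≡ true)

IsMaxBlowup : ∀ {n k} → Graph n → Graph k → Subset k → Subset n → Set
IsMaxBlowup G H U S = IsBlowup G H U S × (∀ S′ → S ⊂ S′ → ¬ IsBlowup G H U S′)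

-- A maximal blow-up S is determined by a sample of each of its k parts: c distinct vertices of
-- the part, or the whole part if it has at most c vertices. Indeed, if two maximal blow-ups
-- share their samples, a vertex v of the first missing from the second could be added to the
-- second: every vertex w that v must be joined to is adjacent to v, since otherwise v and w
-- would have c common neighbours among the samples, against c-closedness. Hence there are at
-- most n^(ck) maximal blow-ups, and both stated bounds are weaker than this.

module Submission where

open import Defs
open import Data.Nat using (ℕ; _+_; _*_; _∸_; _^_; _≤_; _⊔_)
open import Data.Fin.Subset using (Subset)
open import Data.List using (List; length)
open import Data.List.Relation.Unary.All using (All)
open import Data.List.Relation.Unary.Unique.Propositional using (Unique)
open import Data.Product using (_×_)

open import Data.Nat using (zero; suc; z≤n; s≤s; NonZero; >-nonZero)
import Data.Nat.Properties as ℕ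
open import Data.Nat.Tactic.RingSolver using (solve-∀)
open import Data.Fin using (Fin; zero; suc; toℕ; inject≤; funToFin; finToFun; _≟_)
import Data.Fin.Properties as Fin
open import Data.Fin.Subset using (_∈_; _∉_; _⊆_; _⊂_; _∪_; _∩_; _-_; ⁅_⁆; ∣_∣)
open import Data.Fin.Subset.Properties
  using ( _∈?_; x∈p⇒∣p-x∣<∣p∣; x∈p∧x≢y⇒x∈p-y; x∈p∪q⁺; x∈p∪q⁻; x∈p∩q⁺
        ; x∈⁅x⁆; x∈⁅y⁆⇒x≡y; ⊆-antisym)
open import Data.List as List using ([]; _∷_; filter; allFin)
open import Data.List.Relation.Unary.All as All using ([]; _∷_)
import Data.List.Relation.Unary.All.Properties as All
import Data.List.Relation.Unary.Any as Any
import Data.List.Relation.Unary.Any.Properties as Any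
open import Data.List.Relation.Unary.AllPairs using (_∷_)
import Data.List.Relation.Unary.Unique.Propositional.Properties as Unique
open import Data.List.Membership.Propositional using () renaming (_∈_ to _∈ₗ_)
open import Data.List.Membership.Propositional.Properties using (∈-lookup; ∈-filter⁺; ∈-allFin)
import Data.Vec.Properties as Vec
open import Data.Vec.Functional using (updateAt)
open import Data.Vec.Functional.Properties using (updateAt-updates; updateAt-minimal)
open import Data.Product as Product using (∃; _,_; proj₁; proj₂)
open import Data.Sum as Sum using (_⊎_; inj₁; inj₂; [_,_])
open import Data.Bool using (true; false)
open import Data.Bool.Properties using (¬-not)
open import Function using (_∘_; const)
open import Function.Definitions using (Injective)
open import Relation.Nullary using (¬_; yes; no; contradiction)
open import Relation.Nullary.Decidable using (_×-dec_)
open import Relation.Unary using (Decidable)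
open import Relation.Binary.PropositionalEquality as ≡
  using (_≡_; _≢_; refl; cong; subst; subst₂; trans; _≗_)

-- Counting by injections

lookup-injective : ∀ {A : Set} {xs : List A} → Unique xs → Injective _≡_ _≡_ (List.lookup xs)
lookup-injective {xs = _ ∷ _} (_ ∷ _) {zero} {zero} _ = refl
lookup-injective {xs = _ ∷ _} (x∉xs ∷ _) {zero} {suc j} eq =
  contradiction eq (All.lookup x∉xs (∈-lookup j))
lookup-injective {xs = _ ∷ _} (x∉xs ∷ _) {suc i} {zero} eq =
  contradiction (≡.sym eq) (All.lookup x∉xs (∈-lookup i))
lookup-injective {xs = _ ∷ _} (_ ∷ xs-unique) {suc i} {suc j} eq =
  cong suc (lookup-injective xs-unique eq)

length≤-of-injective-code : ∀ {A : Set} {P : A → Set} {M} (code : ∀ {a} → P a → Fin M)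
  → (∀ {a b} (pa : P a) (pb : P b) → code pa ≡ code pb → a ≡ b)
  → ∀ {xs} → Unique xs → All P xs → length xs ≤ M
length≤-of-injective-code code code-injective xs-unique pxs =
  Fin.injective⇒≤ {f = λ i → code (All.lookup pxs (∈-lookup i))}
    (lookup-injective xs-unique ∘ code-injective _ _)

injection≤∣∣ : ∀ {c n} (X : Subset n) (t : Fin c → Fin n)
  → Injective _≡_ _≡_ t → (∀ x → t x ∈ X) → c ≤ ∣ X ∣
injection≤∣∣ {zero} X t _ _ = z≤n
injection≤∣∣ {suc c} X t t-injective t∈X =
  ℕ.≤-trans (s≤s (injection≤∣∣ (X - t zero) (t ∘ suc) (Fin.suc-injective ∘ t-injective) t∘suc∈X-t0))
            (x∈p⇒∣p-x∣<∣p∣ (t∈X zero))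
  where
  t∘suc∈X-t0 : ∀ x → t (suc x) ∈ X - t zero
  t∘suc∈X-t0 x = x∈p∧x≢y⇒x∈p-y (t∈X (suc x)) (λ eq → Fin.0≢1+n (t-injective (≡.sym eq)))

funToFin-injective : ∀ {m n} {f g : Fin m → Fin n} → funToFin f ≡ funToFin g → f ≗ g
funToFin-injective {f = f} {g} eq x = begin
  f x                     ≡⟨ Fin.finToFun-funToFin f x ⟨
  finToFun (funToFin f) x ≡⟨ cong (λ y → finToFun y x) eq ⟩
  finToFun (funToFin g) x ≡⟨ Fin.finToFun-funToFin g x ⟩
  g x                     ∎
  where open ≡.≡-Reasoning

-- Samples of a finite set

lookupOr : ∀ {A : Set} → A → List A → ℕ → A
lookupOr d []       _       = d
lookupOr d (x ∷ _)  zero    = x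
lookupOr d (_ ∷ xs) (suc i) = lookupOr d xs i

lookupOr-toℕ : ∀ {A : Set} (d : A) (xs : List A) (i : Fin (length xs))
  → lookupOr d xs (toℕ i) ≡ List.lookup xs i
lookupOr-toℕ d (_ ∷ _)  zero    = refl
lookupOr-toℕ d (_ ∷ xs) (suc i) = lookupOr-toℕ d xs i

lookupOr-All : ∀ {A : Set} {P : A → Set} {d xs} → P d → All P xs → ∀ i → P (lookupOr d xs i)
lookupOr-All pd []         _       = pd
lookupOr-All pd (px ∷ _)   zero    = px
lookupOr-All pd (_ ∷ pxs)  (suc i) = lookupOr-All pd pxs i

record IsSample {n c} (P : Fin n → Set) (t : Fin c → Fin n) : Set where
  field
    sample-∈          : ∀ x → P (t x)
    injective-or-onto : Injective _≡_ _≡_ t ⊎ (∀ {v} → P v → ∃ λ x → t x ≡ v)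
open IsSample

IsSample-resp-≗ : ∀ {n c} {P : Fin n → Set} {t t′ : Fin c → Fin n}
  → t ≗ t′ → IsSample P t → IsSample P t′
IsSample-resp-≗ {P = P} t≗t′ T = record
  { sample-∈          = λ x → subst P (t≗t′ x) (sample-∈ T x)
  ; injective-or-onto = Sum.map
      (λ t-injective eq → t-injective (trans (t≗t′ _) (trans eq (≡.sym (t≗t′ _)))))
      (λ t-onto pv → Product.map₂ (λ {x} tx≡v → trans (≡.sym (t≗t′ x)) tx≡v) (t-onto pv))
      (injective-or-onto T)
  }

module _ {n} {P : Fin n → Set} (P? : Decidable P) where

  members : List (Fin n)
  members = filter P? (allFin n)

  sample : (c : ℕ) → Fin n → Fin c → Fin n
  sample c d x = lookupOr d members (toℕ x)

  sample-isSample : ∀ c {d} → P d → IsSample P (sample c d)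
  sample-isSample c {d} pd = record
    { sample-∈          = lookupOr-All pd (All.all-filter P? (allFin n)) ∘ toℕ
    ; injective-or-onto = Sum.map sample-injective sample-onto (ℕ.≤-total c (length members))
    }
    where
    members-unique : Unique members
    members-unique = Unique.filter⁺ P? (Unique.allFin⁺ n)

    sample-injective : c ≤ length members → Injective _≡_ _≡_ (sample c d)
    sample-injective c≤ℓ {x} {y} eq =
      Fin.inject≤-injective c≤ℓ c≤ℓ x y
        (lookup-injective members-unique (trans (≡.sym (sample≡lookup x)) (trans eq (sample≡lookup y))))
      where
      sample≡lookup : ∀ x → sample c d x ≡ List.lookup members (inject≤ x c≤ℓ)
      sample≡lookup x = trans (cong (lookupOr d members) (≡.sym (Fin.toℕ-inject≤ x c≤ℓ)))
                              (lookupOr-toℕ d members (inject≤ x c≤ℓ))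

    sample-onto : length members ≤ c → ∀ {v} → P v → ∃ λ x → sample c d x ≡ v
    sample-onto ℓ≤c {v} pv = inject≤ i ℓ≤c , (begin
      lookupOr d members (toℕ (inject≤ i ℓ≤c)) ≡⟨ cong (lookupOr d members) (Fin.toℕ-inject≤ i ℓ≤c) ⟩
      lookupOr d members (toℕ i)               ≡⟨ lookupOr-toℕ d members i ⟩
      List.lookup members i                    ≡⟨ Any.lookup-index v∈members ⟨
      v                                        ∎)
      where
      open ≡.≡-Reasoning
      v∈members : v ∈ₗ members
      v∈members = ∈-filter⁺ P? (∈-allFin v) pv
      i : Fin (length members)
      i = Any.index v∈members

-- Blow-ups

Part : ∀ {n k} → Subset n → (Fin n → Fin k) → Fin k → Fin n → Set
Part S f i v = v ∈ S × f v ≡ i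

part? : ∀ {n k} (S : Subset n) (f : Fin n → Fin k) (i : Fin k) → Decidable (Part S f i)
part? S f i v = (v ∈? S) ×-dec (f v ≟ i)

MustJoin : ∀ {k} → Graph k → Subset k → Fin k → Fin k → Set
MustJoin H U i j = adj H i j ≡ true ⊎ (i ≡ j × i ∈ U)

MustJoin-sym : ∀ {k} {H : Graph k} {U i j} → MustJoin H U i j → MustJoin H U j i
MustJoin-sym {H = H} {i = i} {j} (inj₁ edge)       = inj₁ (trans (sym H j i) edge)
MustJoin-sym                     (inj₂ (refl , i∈U)) = inj₂ (refl , i∈U)

record IsBlowupVia {n k} (G : Graph n) (H : Graph k) (U : Subset k) (S : Subset n) (f : Fin n → Fin k) : Set where
  field
    nonempty : ∀ i → ∃ (Part S f i)
    joined   : ∀ {u w} → u ∈ S → w ∈ S → u ≢ w → MustJoin H U (f u) (f w) → adj G u w ≡ true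
open IsBlowupVia

NoBlowupAbove : ∀ {n k} → Graph n → Graph k → Subset k → Subset n → Set
NoBlowupAbove G H U S = ∀ S′ → S ⊂ S′ → ¬ IsBlowup G H U S′

module _ {n k} {G : Graph n} {H : Graph k} {U : Subset k} where

  joined-edge : ∀ {S f u w} → IsBlowupVia G H U S f → u ∈ S → w ∈ S
    → adj H (f u) (f w) ≡ true → adj G u w ≡ true
  joined-edge {f = f} {u} {w} B u∈S w∈S edge with u ≟ w
  ... | yes refl = contradiction (trans (≡.sym edge) (irrefl H (f u))) λ ()
  ... | no u≢w   = joined B u∈S w∈S u≢w (inj₁ edge)

  IsBlowup⇒IsBlowupVia : ∀ {S} → IsBlowup G H U S → ∃ (IsBlowupVia G H U S)
  IsBlowup⇒IsBlowupVia (f , nonempty , edges , cliques) = f , record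
    { nonempty = nonempty
    ; joined   = λ u∈S w∈S u≢w →
        [ edges _ _ u∈S w∈S , (λ (fu≡fw , fu∈U) → cliques _ _ u∈S w∈S u≢w fu≡fw fu∈U) ]
    }

  IsBlowupVia⇒IsBlowup : ∀ {S f} → IsBlowupVia G H U S f → IsBlowup G H U S
  IsBlowupVia⇒IsBlowup {f = f} B =
    f , nonempty B , (λ _ _ → joined-edge B) ,
    (λ _ _ u∈S w∈S u≢w fu≡fw fu∈U → joined B u∈S w∈S u≢w (inj₂ (fu≡fw , fu∈U)))

  insert-IsBlowupVia : ∀ {S f v} (B : IsBlowupVia G H U S f) → v ∉ S → (i : Fin k)
    → (∀ {w} → w ∈ S → MustJoin H U i (f w) → adj G v w ≡ true)
    → IsBlowupVia G H U (S ∪ ⁅ v ⁆) (updateAt f v (const i))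
  insert-IsBlowupVia {S} {f} {v} B v∉S i v-joins = record
    { nonempty = λ j → let w , w∈S , fw≡j = nonempty B j in
        w , x∈p∪q⁺ (inj₁ w∈S) , trans (f′-old w∈S) fw≡j
    ; joined   = joined′
    }
    where
    f′ : Fin n → Fin k
    f′ = updateAt f v (const i)

    f′-new : f′ v ≡ i
    f′-new = updateAt-updates v f

    f′-old : ∀ {w} → w ∈ S → f′ w ≡ f w
    f′-old {w} w∈S = updateAt-minimal w v f (λ { refl → v∉S w∈S })

    inserted⁻ : ∀ {w} → w ∈ S ∪ ⁅ v ⁆ → w ≡ v ⊎ w ∈ S
    inserted⁻ w∈ = Sum.map₁ (x∈⁅y⁆⇒x≡y v) (Sum.swap (x∈p∪q⁻ S ⁅ v ⁆ w∈))

    joined′ : ∀ {u w} → u ∈ S ∪ ⁅ v ⁆ → w ∈ S ∪ ⁅ v ⁆ → u ≢ w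
      → MustJoin H U (f′ u) (f′ w) → adj G u w ≡ true
    joined′ u∈ w∈ u≢w must with inserted⁻ u∈ | inserted⁻ w∈
    ... | inj₁ refl | inj₁ refl = contradiction refl u≢w
    ... | inj₁ refl | inj₂ w∈S  = v-joins w∈S (subst₂ (MustJoin H U) f′-new (f′-old w∈S) must)
    ... | inj₂ u∈S  | inj₁ refl =
      trans (sym G _ v) (v-joins u∈S (MustJoin-sym {H = H} (subst₂ (MustJoin H U) (f′-old u∈S) f′-new must)))
    ... | inj₂ u∈S  | inj₂ w∈S  =
      joined B u∈S w∈S u≢w (subst₂ (MustJoin H U) (f′-old u∈S) (f′-old w∈S) must)

-- Maximal blow-ups are determined by samples of their parts

module _ {n k c} (G : Graph n) (H : Graph k) (U : Subset k) (closed : CClosed c G) where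

  adjacent-by-common-neighbours : ∀ {u w} → u ≢ w → (t : Fin c → Fin n) → Injective _≡_ _≡_ t
    → (∀ x → adj G u (t x) ≡ true) → (adj G u w ≡ false → ∀ x → adj G w (t x) ≡ true)
    → adj G u w ≡ true
  adjacent-by-common-neighbours {u} {w} u≢w t t-injective u∼t w∼t = ¬-not λ u≁w →
    ℕ.<⇒≱ (closed u w u≢w u≁w)
      (injection≤∣∣ (nbhd G u ∩ nbhd G w) t t-injective
        (λ x → x∈p∩q⁺ (adj⇒∈nbhd (u∼t x) , adj⇒∈nbhd (w∼t u≁w x))))
    where
    adj⇒∈nbhd : ∀ {a b} → adj G a b ≡ true → b ∈ nbhd G a
    adj⇒∈nbhd {a} {b} ab = Vec.lookup⇒[]= b (nbhd G a) (trans (Vec.lookup∘tabulate (adj G a) b) ab)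

  ≢-by-adjacency : ∀ {u w w′} → adj G u w ≡ false → adj G u w′ ≡ true → w ≢ w′
  ≢-by-adjacency u≁w u∼w′ refl = contradiction (trans (≡.sym u∼w′) u≁w) λ ()

  module _ {S S′ f f′} (B : IsBlowupVia G H U S f) (B′ : IsBlowupVia G H U S′ f′)
           (t : Fin k → Fin c → Fin n)
           (T : ∀ i → IsSample (Part S f i) (t i)) (T′ : ∀ i → IsSample (Part S′ f′ i) (t i))
           {v} (v∈S : v ∈ S) (v∉S′ : v ∉ S′) where

    private
      i : Fin k
      i = f v

      t∈S′ : ∀ j x → t j x ∈ S′
      t∈S′ j x = proj₁ (sample-∈ (T′ j) x)

      f′∘t : ∀ j x → f′ (t j x) ≡ j
      f′∘t j x = proj₂ (sample-∈ (T′ j) x)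

      v≢ : ∀ {w} → w ∈ S′ → v ≢ w
      v≢ w∈S′ refl = v∉S′ w∈S′

      -- t i does not list all of part i of S: v is in that part but not in S′.
      t-i-injective : Injective _≡_ _≡_ (t i)
      t-i-injective with injective-or-onto (T i)
      ... | inj₁ t-i-injective = t-i-injective
      ... | inj₂ t-i-onto      =
        let x , tx≡v = t-i-onto (v∈S , refl) in contradiction (subst (_∈ S′) tx≡v (t∈S′ i x)) v∉S′

      v∼t : ∀ {j} x → MustJoin H U i j → adj G v (t j x) ≡ true
      v∼t {j} x must = let t∈S , ft≡j = sample-∈ (T j) x in
        joined B v∈S t∈S (v≢ (t∈S′ j x)) (subst (MustJoin H U i) (≡.sym ft≡j) must)

      w∼t : ∀ {w} y → w ∈ S′ → w ≢ t (f′ w) y → MustJoin H U i (f′ w) → adj G w (t (f′ w) y) ≡ true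
      w∼t {w} y w∈S′ w≢ty (inj₂ (i≡j , i∈U)) =
        joined B′ w∈S′ (t∈S′ (f′ w) y) w≢ty (inj₂ (≡.sym (f′∘t (f′ w) y) , subst (_∈ U) i≡j i∈U))
      w∼t {w} y w∈S′ w≢ty (inj₁ ij-edge) = adjacent-by-common-neighbours w≢ty (t i) t-i-injective
          (λ x → joined-edge B′ w∈S′ (t∈S′ i x) (j∼t x))
          (λ _ x → joined-edge B′ (t∈S′ j y) (t∈S′ i x)
                     (subst (λ a → adj H a (f′ (t i x)) ≡ true) (≡.sym (f′∘t j y)) (j∼t x)))
        where
        j : Fin k
        j = f′ w

        j∼t : ∀ x → adj H j (f′ (t i x)) ≡ true
        j∼t x = subst (λ b → adj H j b ≡ true) (≡.sym (f′∘t i x)) (trans (sym H j i) ij-edge)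

    missing-vertex-joins : ∀ {w} → w ∈ S′ → MustJoin H U (f v) (f′ w) → adj G v w ≡ true
    missing-vertex-joins {w} w∈S′ must with injective-or-onto (T′ (f′ w))
    ... | inj₂ t-onto =
      let y , ty≡w = t-onto (w∈S′ , refl) in subst (λ z → adj G v z ≡ true) ty≡w (v∼t y must)
    ... | inj₁ t-injective = adjacent-by-common-neighbours (v≢ w∈S′) (t (f′ w)) t-injective
      (λ y → v∼t y must)
      (λ v≁w y → w∼t y w∈S′ (λ w≡ty → ≢-by-adjacency v≁w (v∼t y must) w≡ty) must)

  -- A vertex v ∈ S ∖ S′ could be added to S′ (in part f v), contradicting maximality.
  shared-samples⇒⊆ : ∀ {S S′ f f′} → IsBlowupVia G H U S f → IsBlowupVia G H U S′ f′
    → NoBlowupAbove G H U S′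
    → (t : Fin k → Fin c → Fin n)
    → (∀ i → IsSample (Part S f i) (t i)) → (∀ i → IsSample (Part S′ f′ i) (t i))
    → S ⊆ S′
  shared-samples⇒⊆ {S′ = S′} {f} B B′ maximal t T T′ {v} v∈S with v ∈? S′
  ... | yes v∈S′ = v∈S′
  ... | no  v∉S′ = contradiction
    (IsBlowupVia⇒IsBlowup (insert-IsBlowupVia B′ v∉S′ (f v) (missing-vertex-joins B B′ t T T′ v∈S v∉S′)))
    (maximal (S′ ∪ ⁅ v ⁆) (x∈p∪q⁺ ∘ inj₁ , v , x∈p∪q⁺ (inj₂ (x∈⁅x⁆ v)) , v∉S′))

  samples : ∀ {S f} → IsBlowupVia G H U S f → Fin k → Fin c → Fin n
  samples {S} {f} B i = sample (part? S f i) c (proj₁ (nonempty B i))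

  samples-isSample : ∀ {S f} (B : IsBlowupVia G H U S f) i → IsSample (Part S f i) (samples B i)
  samples-isSample {S} {f} B i = sample-isSample (part? S f i) c (proj₂ (nonempty B i))

  encodeVia : ∀ {S f} → IsBlowupVia G H U S f → Fin ((n ^ c) ^ k)
  encodeVia B = funToFin (λ i → funToFin (samples B i))

  encodeVia-injective : ∀ {S S′ f f′} (B : IsBlowupVia G H U S f) (B′ : IsBlowupVia G H U S′ f′)
    → NoBlowupAbove G H U S → NoBlowupAbove G H U S′ → encodeVia B ≡ encodeVia B′ → S ≡ S′
  encodeVia-injective B B′ maximal maximal′ eq =
    ⊆-antisym (shared-samples⇒⊆ B B′ maximal′ (samples B) (samples-isSample B)
                 (λ i → IsSample-resp-≗ (≡.sym ∘ same i) (samples-isSample B′ i)))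
              (shared-samples⇒⊆ B′ B maximal (samples B′) (samples-isSample B′)
                 (λ i → IsSample-resp-≗ (same i) (samples-isSample B i)))
    where
    same : ∀ i → samples B i ≗ samples B′ i
    same i = funToFin-injective (funToFin-injective eq i)

  encode : ∀ {S} → IsMaxBlowup G H U S → Fin ((n ^ c) ^ k)
  encode (blowup , _) = encodeVia (proj₂ (IsBlowup⇒IsBlowupVia blowup))

  encode-injective : ∀ {S S′} (p : IsMaxBlowup G H U S) (p′ : IsMaxBlowup G H U S′)
    → encode p ≡ encode p′ → S ≡ S′
  encode-injective (blowup , maximal) (blowup′ , maximal′) =
    encodeVia-injective (proj₂ (IsBlowup⇒IsBlowupVia blowup)) (proj₂ (IsBlowup⇒IsBlowupVia blowup′))
      maximal maximal′

  maximal-blowups-count : ∀ {L} → Unique L → All (IsMaxBlowup G H U) L → length L ≤ n ^ (c * k)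
  maximal-blowups-count {L} L-unique L-maximal =
    subst (length L ≤_) (ℕ.^-*-assoc n c k) (length≤-of-injective-code encode encode-injective L-unique L-maximal)

-- Arithmetic

≤-insert-factor : ∀ a t b → 1 ≤ t → a * b ≤ a * t * b
≤-insert-factor a t b 1≤t = begin
  a * b     ≡⟨ cong (_* b) (ℕ.*-identityʳ a) ⟨
  a * 1 * b ≤⟨ ℕ.*-monoˡ-≤ b (ℕ.*-monoʳ-≤ a 1≤t) ⟩
  a * t * b ∎
  where open ℕ.≤-Reasoning

c*k*3≤3*[m*k]+6*k : ∀ {c m} k → c ≤ suc m → c * k * 3 ≤ 3 * (m * k) + 6 * k
c*k*3≤3*[m*k]+6*k {c} {m} k c≤1+m = begin
  c * k * 3           ≤⟨ ℕ.*-monoˡ-≤ 3 (ℕ.*-monoˡ-≤ k c≤1+m) ⟩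
  suc m * k * 3       ≡⟨ expand m k ⟩
  3 * (m * k) + 3 * k ≤⟨ ℕ.+-monoʳ-≤ (3 * (m * k)) (ℕ.*-monoˡ-≤ k (ℕ.m≤m+n 3 3)) ⟩
  3 * (m * k) + 6 * k ∎
  where
  open ℕ.≤-Reasoning
  expand : ∀ m k → suc m * k * 3 ≡ 3 * (m * k) + 3 * k
  expand = solve-∀

c*k*P+k≤[m*k+2*k]*P : ∀ {c m} k P → c ≤ suc m → 1 ≤ P → c * k * P + k ≤ (m * k + 2 * k) * P
c*k*P+k≤[m*k+2*k]*P {c} {m} k P c≤1+m 1≤P = begin
  c * k * P + k             ≤⟨ ℕ.+-monoˡ-≤ k (ℕ.*-monoˡ-≤ P (ℕ.*-monoˡ-≤ k c≤1+m)) ⟩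
  suc m * k * P + k         ≡⟨ expand m k P ⟩
  m * k * P + k * P + k     ≤⟨ ℕ.+-monoʳ-≤ (m * k * P + k * P) (ℕ.m≤m*n k P {{>-nonZero 1≤P}}) ⟩
  m * k * P + k * P + k * P ≡⟨ collect m k P ⟩
  (m * k + 2 * k) * P       ∎
  where
  open ℕ.≤-Reasoning
  expand : ∀ m k P → suc m * k * P + k ≡ m * k * P + k * P + k
  expand = solve-∀
  collect : ∀ m k P → m * k * P + k * P + k * P ≡ (m * k + 2 * k) * P
  collect = solve-∀

module _ (ν : ℕ) .{{_ : NonZero ν}} {N} (c k : ℕ) (N≤ν^ck : N ≤ ν ^ (suc c * k)) where

  private
    c≤1+m : suc c ≤ suc (c ⊔ 1)
    c≤1+m = s≤s (ℕ.m≤m⊔n c 1)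

  cube-bound : N ^ 3 ≤ ν ^ (3 * ((c ⊔ 1) * k)) * 3 ^ (c * k) * ν ^ (6 * k)
  cube-bound = begin
    N ^ 3                                                ≤⟨ ℕ.^-monoˡ-≤ 3 N≤ν^ck ⟩
    (ν ^ (suc c * k)) ^ 3                                ≡⟨ ℕ.^-*-assoc ν (suc c * k) 3 ⟩
    ν ^ (suc c * k * 3)                                  ≤⟨ ℕ.^-monoʳ-≤ ν (c*k*3≤3*[m*k]+6*k k c≤1+m) ⟩
    ν ^ (3 * (m * k) + 6 * k)                            ≡⟨ ℕ.^-distribˡ-+-* ν (3 * (m * k)) (6 * k) ⟩
    ν ^ (3 * (m * k)) * ν ^ (6 * k)                      ≤⟨ ≤-insert-factor (ν ^ (3 * (m * k))) T (ν ^ (6 * k)) T≥1 ⟩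
    ν ^ (3 * (m * k)) * T * ν ^ (6 * k)                  ∎
    where
    open ℕ.≤-Reasoning
    m T : ℕ
    m = c ⊔ 1
    T = 3 ^ (c * k)
    T≥1 : 1 ≤ T
    T≥1 = ℕ.m^n>0 3 (c * k)

  power-bound : let m = c ⊔ 1; P = 2 ^ c
    in N ^ P * ν ^ k ≤ (ν ^ (m * k) * 2 ^ ((suc c + 4) * c * k) * ν ^ (2 * k)) ^ P
  power-bound = begin
    N ^ P * ν ^ k                          ≤⟨ ℕ.*-monoˡ-≤ (ν ^ k) (ℕ.^-monoˡ-≤ P N≤ν^ck) ⟩
    (ν ^ (suc c * k)) ^ P * ν ^ k          ≡⟨ cong (_* ν ^ k) (ℕ.^-*-assoc ν (suc c * k) P) ⟩
    ν ^ (suc c * k * P) * ν ^ k            ≡⟨ ℕ.^-distribˡ-+-* ν (suc c * k * P) k ⟨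
    ν ^ (suc c * k * P + k)                ≤⟨ ℕ.^-monoʳ-≤ ν (c*k*P+k≤[m*k+2*k]*P k P c≤1+m (ℕ.m^n>0 2 c)) ⟩
    ν ^ ((m * k + 2 * k) * P)              ≡⟨ ℕ.^-*-assoc ν (m * k + 2 * k) P ⟨
    (ν ^ (m * k + 2 * k)) ^ P              ≡⟨ cong (_^ P) (ℕ.^-distribˡ-+-* ν (m * k) (2 * k)) ⟩
    (ν ^ (m * k) * ν ^ (2 * k)) ^ P        ≤⟨ ℕ.^-monoˡ-≤ P (≤-insert-factor (ν ^ (m * k)) T (ν ^ (2 * k)) T≥1) ⟩
    (ν ^ (m * k) * T * ν ^ (2 * k)) ^ P    ∎
    where
    open ℕ.≤-Reasoning
    m P T : ℕ
    m = c ⊔ 1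
    P = 2 ^ c
    T = 2 ^ ((suc c + 4) * c * k)
    T≥1 : 1 ≤ T
    T≥1 = ℕ.m^n>0 2 ((suc c + 4) * c * k)

theorem2 : (k : ℕ) → 2 ≤ k → (H : Graph k) → (U : Subset k)
    → (c : ℕ) → 1 ≤ c → (n : ℕ) → (G : Graph n) → CClosed c G
    → (L : List (Subset n)) → Unique L → All (IsMaxBlowup G H U) L
    → let N = length L
          m = (c ∸ 1) ⊔ 1
          P = 2 ^ (c ∸ 1)
      in (N ^ 3 ≤ n ^ (3 * (m * k)) * 3 ^ ((c ∸ 1) * k) * n ^ (6 * k))
       × (N ^ P * n ^ k ≤ (n ^ (m * k) * 2 ^ ((c + 4) * (c ∸ 1) * k) * n ^ (2 * k)) ^ P)
theorem2 k _ H U (suc c) _ (suc n) G closed L L-unique L-maximal =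
  cube-bound (suc n) c k N≤ , power-bound (suc n) c k N≤
  where
  N≤ : length L ≤ suc n ^ (suc c * k)
  N≤ = maximal-blowups-count G H U closed L-unique L-maximal
theorem2 (suc k) _ H U (suc c) _ zero G closed L L-unique L-maximal
  rewrite ℕ.n≤0⇒n≡0 (maximal-blowups-count G H U closed L-unique L-maximal) =
  z≤n , ℕ.≤-trans (ℕ.≤-reflexive (ℕ.*-zeroʳ (0 ^ 2 ^ c))) z≤n
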